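{- Let $M$ be a matroid on a finite set $E$ and let $\mathcal{I}\subseteq\mathcal{P}(E)$ be an order ideal (a down-closed family of subsets of $E$). Then $\mathcal{I}$ is a modular ideal of $M$ if and only if all of the following hold: (a) $\mathcal{I}\cap\mathcal{C}(M)$ is a linear class of circuits of $M$; (b) every independent set of $M$ belongs to $\mathcal{I}$; (c) $\mathcal{I}$ satisfies modular extension by circuits.
   Context: $\mathcal{C}(M)$ denotes the set of circuits of $M$ and $\operatorname{rk}$ its rank function. Distinct sets $S,T\subseteq E$ form a modular pair if $\operatorname{rk}(S\cap T)+\operatorname{rk}(S\cup T)=\operatorname{rk}S+\operatorname{rk}T$. A modular ideal of $M$ is a nonempty order ideal $\mathcal{I}$ of $(\mathcal{P}(E),\subseteq)$ (possibly all of $\mathcal{P}(E)$) such that (MI1) $\{e\}\in\mathcal{I}$ for every non-loop $e\in E$, and (MI2) $A\cup B\in\mathcal{I}$ for every modular pair $A,B\in\mathcal{I}$. A linear class of circuits is a set $\mathcal{L}\subseteq\mathcal{C}(M)$ such that for every modular pair $X,Y\in\mathcal{L}$, every circuit contained in $X\cup Y$ lies in $\mathcal{L}$. An ideal $\mathcal{I}$ satisfies modular extension by circuits if for all $X\in\mathcal{I}\cap\mathcal{C}(M)$, all $S\in\mathcal{I}$ and all $e\in E$ with $e\in X\subseteq S\cup\{e\}$, we have $S\cup\{e\}\in\mathcal{I}$. -}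

module Defs where

open import Data.Nat using (ℕ; _≤_; _+_)
open import Data.Fin using (Fin)
open import Data.Fin.Subset using (Subset; _⊆_; _⊂_; _∈_; _∩_; _∪_; ⁅_⁆; ∣_∣)
open import Data.Product using (_×_; ∃)
open import Relation.Binary.PropositionalEquality using (_≡_; _≢_)
open import Relation.Nullary using (¬_)

record Matroid (n : ℕ) : Set where
  field
    rk       : Subset n → ℕ
    rk-bound : ∀ X → rk X ≤ ∣ X ∣
    rk-mono  : ∀ {X Y} → X ⊆ Y → rk X ≤ rk Y
    rk-submod : ∀ X Y → rk (X ∪ Y) + rk (X ∩ Y) ≤ rk X + rk Y

module _ {n : ℕ} (M : Matroid n) where
  open Matroid M

  Independent : Subset n → Set
  Independent X = rk X ≡ ∣ X ∣

  Circuit : Subset n → Set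
  Circuit C = ¬ Independent C × (∀ D → D ⊂ C → Independent D)

  NonLoop : Fin n → Set
  NonLoop e = ¬ Circuit ⁅ e ⁆

  ModularPair : Subset n → Subset n → Set
  ModularPair S T = S ≢ T × rk (S ∩ T) + rk (S ∪ T) ≡ rk S + rk T

  IsOrderIdeal : (Subset n → Set) → Set
  IsOrderIdeal I = ∀ A B → A ⊆ B → I B → I A

  IsModularIdeal : (Subset n → Set) → Set
  IsModularIdeal I =
    ∃ I × IsOrderIdeal I
    × (∀ e → NonLoop e → I ⁅ e ⁆)
    × (∀ A B → I A → I B → ModularPair A B → I (A ∪ B))

  IsLinearClass : (Subset n → Set) → Set
  IsLinearClass L =
    (∀ X → L X → Circuit X)
    × (∀ X Y → L X → L Y → ModularPair X Y →
         ∀ C → Circuit C → C ⊆ X ∪ Y → L C)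

  IdealCircuits : (Subset n → Set) → Subset n → Set
  IdealCircuits I X = I X × Circuit X

  ModularExtensionByCircuits : (Subset n → Set) → Set
  ModularExtensionByCircuits I =
    ∀ X S e → I X → Circuit X → I S → e ∈ X → X ⊆ S ∪ ⁅ e ⁆ → I (S ∪ ⁅ e ⁆)

-- Forward: (a) is MI2 followed by down-closure; an independent set is built
-- one element at a time, each step being a modular pair S, {x} inside an
-- independent set; and for a circuit X with x ∈ X ⊆ S ∪ {x}, x ∉ S, the
-- proper subset S ∩ X of X already has the rank of X, so S, X is a modular pair.
-- Backward: MI1 holds because a non-loop is independent.
-- For MI2, if T ⊆ A is an independent set spanning A and I ∋ S ⊇ T, then every
-- x ∈ A ∖ S lies on a circuit inside T ∪ {x}, so modular extension adds the
-- elements of A to S one by one and gives S ∪ A ∈ I.  For a modular pair A, B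
-- take bases T_A ⊇ J ⊆ T_B of A and B through a basis J of A ∩ B; modularity
-- forces T_A ∪ T_B to be independent, hence in I, and extending it by A and
-- then by B gives A ∪ B ∈ I.
module Submission where

open import Defs
open import Data.Nat using (ℕ; zero; suc; _+_; _≤_; _<_)
open import Data.Nat.Properties
open import Data.Fin using (Fin)
open import Data.Fin.Properties using (any?)
open import Data.Fin.Subset
open import Data.Fin.Subset.Properties
open import Data.Vec using (_∷_; [])
open import Data.Product
open import Data.Sum using (_⊎_; inj₁; inj₂)
open import Data.Empty using (⊥-elim)
open import Relation.Nullary
open import Relation.Nullary.Decidable using (_×-dec_; ¬?; decidable-stable)
open import Relation.Binary.PropositionalEquality
open import Function.Base using (_∘_)
open import Function.Bundles using (_⇔_; mk⇔)

∣p∪q∣+∣p∩q∣≡∣p∣+∣q∣ : ∀ {n} (p q : Subset n) → ∣ p ∪ q ∣ + ∣ p ∩ q ∣ ≡ ∣ p ∣ + ∣ q ∣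
∣p∪q∣+∣p∩q∣≡∣p∣+∣q∣ []            []            = refl
∣p∪q∣+∣p∩q∣≡∣p∣+∣q∣ (outside ∷ p) (outside ∷ q) = ∣p∪q∣+∣p∩q∣≡∣p∣+∣q∣ p q
∣p∪q∣+∣p∩q∣≡∣p∣+∣q∣ (outside ∷ p) (inside ∷ q)  =
  trans (cong suc (∣p∪q∣+∣p∩q∣≡∣p∣+∣q∣ p q)) (sym (+-suc ∣ p ∣ ∣ q ∣))
∣p∪q∣+∣p∩q∣≡∣p∣+∣q∣ (inside ∷ p)  (outside ∷ q) = cong suc (∣p∪q∣+∣p∩q∣≡∣p∣+∣q∣ p q)
∣p∪q∣+∣p∩q∣≡∣p∣+∣q∣ (inside ∷ p)  (inside ∷ q)  = cong suc (begin
  ∣ p ∪ q ∣ + suc ∣ p ∩ q ∣ ≡⟨ +-suc ∣ p ∪ q ∣ ∣ p ∩ q ∣ ⟩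
  suc (∣ p ∪ q ∣ + ∣ p ∩ q ∣) ≡⟨ cong suc (∣p∪q∣+∣p∩q∣≡∣p∣+∣q∣ p q) ⟩
  suc (∣ p ∣ + ∣ q ∣)         ≡⟨ +-suc ∣ p ∣ ∣ q ∣ ⟨
  ∣ p ∣ + suc ∣ q ∣           ∎)
  where open ≡-Reasoning

module _ {n : ℕ} where

  ∪-lub : {p q r : Subset n} → p ⊆ r → q ⊆ r → p ∪ q ⊆ r
  ∪-lub {p} {q} p⊆r q⊆r x∈p∪q with x∈p∪q⁻ p q x∈p∪q
  ... | inj₁ x∈p = p⊆r x∈p
  ... | inj₂ x∈q = q⊆r x∈q

  ∪-mono : {p q r s : Subset n} → p ⊆ r → q ⊆ s → p ∪ q ⊆ r ∪ s
  ∪-mono {r = r} {s} p⊆r q⊆s = ∪-lub (p⊆p∪q s ∘ p⊆r) (q⊆p∪q r s ∘ q⊆s)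

  x∈p⇒⁅x⁆⊆p : {x : Fin n} {p : Subset n} → x ∈ p → ⁅ x ⁆ ⊆ p
  x∈p⇒⁅x⁆⊆p {x} x∈p y∈⁅x⁆ = subst (_∈ _) (sym (x∈⁅y⁆⇒x≡y x y∈⁅x⁆)) x∈p

  Empty⇒∣p∣≡0 : {p : Subset n} → Empty p → ∣ p ∣ ≡ 0
  Empty⇒∣p∣≡0 empty = trans (cong ∣_∣ (Empty-unique empty)) (∣⊥∣≡0 n)

  Empty[p∩q]⇒∣p∪q∣≡∣p∣+∣q∣ : (p q : Subset n) → Empty (p ∩ q) → ∣ p ∪ q ∣ ≡ ∣ p ∣ + ∣ q ∣
  Empty[p∩q]⇒∣p∪q∣≡∣p∣+∣q∣ p q disjoint = begin
    ∣ p ∪ q ∣               ≡⟨ +-identityʳ _ ⟨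
    ∣ p ∪ q ∣ + 0           ≡⟨ cong (∣ p ∪ q ∣ +_) (Empty⇒∣p∣≡0 disjoint) ⟨
    ∣ p ∪ q ∣ + ∣ p ∩ q ∣   ≡⟨ ∣p∪q∣+∣p∩q∣≡∣p∣+∣q∣ p q ⟩
    ∣ p ∣ + ∣ q ∣           ∎
    where open ≡-Reasoning

  x∉p⇒∣p∪⁅x⁆∣≡1+∣p∣ : {x : Fin n} {p : Subset n} → x ∉ p → ∣ p ∪ ⁅ x ⁆ ∣ ≡ suc ∣ p ∣
  x∉p⇒∣p∪⁅x⁆∣≡1+∣p∣ {x} {p} x∉p = begin
    ∣ p ∪ ⁅ x ⁆ ∣     ≡⟨ Empty[p∩q]⇒∣p∪q∣≡∣p∣+∣q∣ p ⁅ x ⁆ disjoint ⟩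
    ∣ p ∣ + ∣ ⁅ x ⁆ ∣ ≡⟨ cong (∣ p ∣ +_) (∣⁅x⁆∣≡1 x) ⟩
    ∣ p ∣ + 1         ≡⟨ +-comm ∣ p ∣ 1 ⟩
    suc ∣ p ∣         ∎
    where
    open ≡-Reasoning
    disjoint : Empty (p ∩ ⁅ x ⁆)
    disjoint (y , y∈p∩⁅x⁆) with x∈p∩q⁻ p ⁅ x ⁆ y∈p∩⁅x⁆
    ... | y∈p , y∈⁅x⁆ = x∉p (subst (_∈ p) (x∈⁅y⁆⇒x≡y x y∈⁅x⁆) y∈p)

  ∃∈∉⊎⊆ : (p q : Subset n) → (∃ λ x → x ∈ p × x ∉ q) ⊎ p ⊆ q
  ∃∈∉⊎⊆ p q with any? (λ x → (x ∈? p) ×-dec ¬? (x ∈? q))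
  ... | yes witness = inj₁ witness
  ... | no none     = inj₂ λ {x} x∈p →
    decidable-stable (x ∈? q) (λ x∉q → none (x , x∈p , x∉q))

  -- Each step adds a new element, so it can happen at most n times.
  augment : (P Q : Subset n → Set) →
    (∀ S → P S → Q S ⊎ ∃ λ x → x ∉ S × P (S ∪ ⁅ x ⁆)) →
    ∀ S → P S → ∃ λ S′ → S ⊆ S′ × P S′ × Q S′
  augment P Q step S = go n S (m≤n+m n ∣ S ∣)
    where
    go : ∀ k S → n ≤ ∣ S ∣ + k → P S → ∃ λ S′ → S ⊆ S′ × P S′ × Q S′
    go k S room pS with step S pS
    ... | inj₁ qS = S , ⊆-refl , pS , qS
    go zero S room pS | inj₂ (x , x∉S , _) =
      ⊥-elim (<⇒≱ (subst (_≤ n) (x∉p⇒∣p∪⁅x⁆∣≡1+∣p∣ x∉S) (∣p∣≤n (S ∪ ⁅ x ⁆)))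
                  (≤-trans room (≤-reflexive (+-identityʳ ∣ S ∣))))
    go (suc k) S room pS | inj₂ (x , x∉S , pS∪x)
      with go k (S ∪ ⁅ x ⁆) (≤-trans room (≤-reflexive room′)) pS∪x
      where
      room′ : ∣ S ∣ + suc k ≡ ∣ S ∪ ⁅ x ⁆ ∣ + k
      room′ = trans (+-suc ∣ S ∣ k) (cong (_+ k) (sym (x∉p⇒∣p∪⁅x⁆∣≡1+∣p∣ x∉S)))
    ... | S′ , S∪x⊆S′ , pS′ , qS′ = S′ , (λ x∈S → S∪x⊆S′ (p⊆p∪q ⁅ x ⁆ x∈S)) , pS′ , qS′

  saturate : (P : Subset n → Set) (A : Subset n) →
    (∀ S x → P S → x ∈ A → x ∉ S → P (S ∪ ⁅ x ⁆)) →
    ∀ S → P S → ∃ λ S′ → S ∪ A ⊆ S′ × P S′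
  saturate P A closed S pS with augment P (A ⊆_) step S pS
    where
    step : ∀ T → P T → A ⊆ T ⊎ ∃ λ x → x ∉ T × P (T ∪ ⁅ x ⁆)
    step T pT with ∃∈∉⊎⊆ A T
    ... | inj₁ (x , x∈A , x∉T) = inj₂ (x , x∉T , closed T x pT x∈A x∉T)
    ... | inj₂ A⊆T             = inj₁ A⊆T
  ... | S′ , S⊆S′ , pS′ , A⊆S′ = S′ , ∪-lub S⊆S′ A⊆S′ , pS′

module _ {n : ℕ} (M : Matroid n) where
  open Matroid M

  rk-subadditive : ∀ X Y → rk (X ∪ Y) ≤ rk X + rk Y
  rk-subadditive X Y = ≤-trans (m≤m+n _ _) (rk-submod X Y)

  ∣X∣≡0⇒independent : ∀ {X} → ∣ X ∣ ≡ 0 → Independent M X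
  ∣X∣≡0⇒independent {X} ∣X∣≡0 =
    trans (n≤0⇒n≡0 (subst (rk X ≤_) ∣X∣≡0 (rk-bound X))) (sym ∣X∣≡0)

  independent-⊥ : Independent M ⊥
  independent-⊥ = ∣X∣≡0⇒independent (∣⊥∣≡0 n)

  independent-⊆ : ∀ {D X} → D ⊆ X → Independent M X → Independent M D
  independent-⊆ {D} {X} D⊆X indX =
    ≤-antisym (rk-bound D) (+-cancelʳ-≤ ∣ R ∣ ∣ D ∣ (rk D) chain)
    where
    R : Subset n
    R = X ∩ ∁ D
    X⊆D∪R : X ⊆ D ∪ R
    X⊆D∪R {x} x∈X with x ∈? D
    ... | yes x∈D = p⊆p∪q R x∈D
    ... | no  x∉D = q⊆p∪q D R (x∈p∩q⁺ (x∈X , x∉p⇒x∈∁p x∉D))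
    disjoint : Empty (D ∩ R)
    disjoint (x , x∈D∩R) with x∈p∩q⁻ D R x∈D∩R
    ... | x∈D , x∈R = x∈p⇒x∉∁p x∈D (p∩q⊆q X (∁ D) x∈R)
    open ≤-Reasoning
    chain : ∣ D ∣ + ∣ R ∣ ≤ rk D + ∣ R ∣
    chain = begin
      ∣ D ∣ + ∣ R ∣  ≡⟨ Empty[p∩q]⇒∣p∪q∣≡∣p∣+∣q∣ D R disjoint ⟨
      ∣ D ∪ R ∣      ≤⟨ p⊆q⇒∣p∣≤∣q∣ (∪-lub D⊆X (p∩q⊆p X (∁ D))) ⟩
      ∣ X ∣          ≡⟨ indX ⟨
      rk X           ≤⟨ rk-mono X⊆D∪R ⟩
      rk (D ∪ R)     ≤⟨ rk-subadditive D R ⟩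
      rk D + rk R    ≤⟨ +-monoʳ-≤ (rk D) (rk-bound R) ⟩
      rk D + ∣ R ∣   ∎

  dependent⇒∃circuit : ∀ {D} → ¬ Independent M D → ∃ λ C → Circuit M C × C ⊆ D
  dependent⇒∃circuit {D} depD = go (suc ∣ D ∣) D ≤-refl depD
    where
    go : ∀ k X → ∣ X ∣ < k → ¬ Independent M X → ∃ λ C → Circuit M C × C ⊆ X
    go k X ∣X∣<k depX with anySubset? (λ Y → (Y ⊂? X) ×-dec ¬? (rk Y ≟ ∣ Y ∣))
    ... | no noSmaller = X , (depX , minimal) , ⊆-refl
      where
      minimal : ∀ Y → Y ⊂ X → Independent M Y
      minimal Y Y⊂X = decidable-stable (rk Y ≟ ∣ Y ∣) (λ depY → noSmaller (Y , Y⊂X , depY))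
    go (suc k) X ∣X∣<k depX | yes (Y , Y⊂X , depY)
      with go k Y (<-≤-trans (p⊂q⇒∣p∣<∣q∣ Y⊂X) (≤-pred ∣X∣<k)) depY
    ... | C , circuitC , C⊆Y = C , circuitC , ⊆-trans C⊆Y (p⊂q⇒p⊆q Y⊂X)

  fundamentalCircuit : ∀ {T x} → Independent M T → ¬ Independent M (T ∪ ⁅ x ⁆) →
    ∃ λ C → Circuit M C × x ∈ C × C ⊆ T ∪ ⁅ x ⁆
  fundamentalCircuit {T} {x} indT depT∪x with dependent⇒∃circuit depT∪x
  ... | C , circuitC , C⊆T∪x with x ∈? C
  ...   | yes x∈C = C , circuitC , x∈C , C⊆T∪x
  ...   | no  x∉C = ⊥-elim (proj₁ circuitC (independent-⊆ C⊆T indT))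
    where
    C⊆T : C ⊆ T
    C⊆T {y} y∈C with x∈p∪q⁻ T ⁅ x ⁆ (C⊆T∪x y∈C)
    ... | inj₁ y∈T   = y∈T
    ... | inj₂ y∈⁅x⁆ = ⊥-elim (x∉C (subst (_∈ C) (x∈⁅y⁆⇒x≡y x y∈⁅x⁆) y∈C))

  circuit-rk≤rk∩ : ∀ {C S x} → Circuit M C → x ∈ C → C ⊆ S ∪ ⁅ x ⁆ → x ∉ S →
    rk C ≤ rk (S ∩ C)
  circuit-rk≤rk∩ {C} {S} {x} (depC , minimalC) x∈C C⊆S∪x x∉S = ≤-pred (begin
    suc (rk C)          ≤⟨ ≤∧≢⇒< (rk-bound C) depC ⟩
    ∣ C ∣               ≤⟨ p⊆q⇒∣p∣≤∣q∣ C⊆S∩C∪x ⟩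
    ∣ S ∩ C ∪ ⁅ x ⁆ ∣   ≡⟨ x∉p⇒∣p∪⁅x⁆∣≡1+∣p∣ (x∉S ∘ proj₁ ∘ x∈p∩q⁻ S C) ⟩
    suc ∣ S ∩ C ∣       ≡⟨ cong suc (minimalC (S ∩ C) S∩C⊂C) ⟨
    suc (rk (S ∩ C))    ∎)
    where
    open ≤-Reasoning
    S∩C⊂C : S ∩ C ⊂ C
    S∩C⊂C = p∩q⊆q S C , x , x∈C , x∉S ∘ proj₁ ∘ x∈p∩q⁻ S C
    C⊆S∩C∪x : C ⊆ S ∩ C ∪ ⁅ x ⁆
    C⊆S∩C∪x {y} y∈C with x∈p∪q⁻ S ⁅ x ⁆ (C⊆S∪x y∈C)
    ... | inj₁ y∈S   = p⊆p∪q ⁅ x ⁆ (x∈p∩q⁺ (y∈S , y∈C))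
    ... | inj₂ y∈⁅x⁆ = q⊆p∪q (S ∩ C) ⁅ x ⁆ y∈⁅x⁆

  rk≤rk∩⇒modular : ∀ X Y → rk Y ≤ rk (X ∩ Y) → rk (X ∩ Y) + rk (X ∪ Y) ≡ rk X + rk Y
  rk≤rk∩⇒modular X Y rkY≤ = ≤-antisym
    (subst (_≤ rk X + rk Y) (+-comm (rk (X ∪ Y)) (rk (X ∩ Y))) (rk-submod X Y))
    (subst (rk X + rk Y ≤_) (+-comm (rk (X ∪ Y)) (rk (X ∩ Y)))
           (+-mono-≤ (rk-mono (p⊆p∪q Y)) rkY≤))

  independent⇒modular : ∀ X Y → Independent M (X ∪ Y) →
    rk (X ∩ Y) + rk (X ∪ Y) ≡ rk X + rk Y
  independent⇒modular X Y indX∪Y = begin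
    rk (X ∩ Y) + rk (X ∪ Y) ≡⟨ cong₂ _+_ (indep (⊆-trans (p∩q⊆p X Y) (p⊆p∪q Y))) indX∪Y ⟩
    ∣ X ∩ Y ∣ + ∣ X ∪ Y ∣   ≡⟨ +-comm ∣ X ∩ Y ∣ ∣ X ∪ Y ∣ ⟩
    ∣ X ∪ Y ∣ + ∣ X ∩ Y ∣   ≡⟨ ∣p∪q∣+∣p∩q∣≡∣p∣+∣q∣ X Y ⟩
    ∣ X ∣ + ∣ Y ∣           ≡⟨ cong₂ _+_ (indep (p⊆p∪q Y)) (indep (q⊆p∪q X Y)) ⟨
    rk X + rk Y             ∎
    where
    open ≡-Reasoning
    indep : ∀ {D} → D ⊆ X ∪ Y → Independent M D
    indep D⊆ = independent-⊆ D⊆ indX∪Y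

  nonLoop⇒independent : ∀ {x} → NonLoop M x → Independent M ⁅ x ⁆
  nonLoop⇒independent {x} nonLoop =
    decidable-stable (rk ⁅ x ⁆ ≟ ∣ ⁅ x ⁆ ∣) (λ dep → nonLoop (dep , properSubsets))
    where
    properSubsets : ∀ D → D ⊂ ⁅ x ⁆ → Independent M D
    properSubsets D D⊂⁅x⁆ = ∣X∣≡0⇒independent
      (n<1⇒n≡0 (subst (∣ D ∣ <_) (∣⁅x⁆∣≡1 x) (p⊂q⇒∣p∣<∣q∣ D⊂⁅x⁆)))

  -- A ⊆ cl(T) in terms of the closure operator.
  _Spans_ : Subset n → Subset n → Set
  T Spans A = rk (T ∪ A) ≤ rk T

  Spans⇒rk≤ : ∀ {T A} → T Spans A → rk A ≤ rk T
  Spans⇒rk≤ {T} {A} T⊒A = ≤-trans (rk-mono (q⊆p∪q T A)) T⊒A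

  Spans-⊆ : ∀ {T A B} → A ⊆ B → T Spans B → T Spans A
  Spans-⊆ A⊆B T⊒B = ≤-trans (rk-mono (∪-mono ⊆-refl A⊆B)) T⊒B

  Spans-⊇ : ∀ {T X A} → T ⊆ X → T Spans A → X Spans A
  Spans-⊇ {T} {X} {A} T⊆X T⊒A = ≤-trans (rk-mono X∪A⊆) (+-cancelʳ-≤ _ _ _ (begin
    rk (X ∪ (T ∪ A)) + rk (X ∩ (T ∪ A)) ≤⟨ rk-submod X (T ∪ A) ⟩
    rk X + rk (T ∪ A)                   ≤⟨ +-monoʳ-≤ (rk X) T⊒A ⟩
    rk X + rk T                         ≤⟨ +-monoʳ-≤ (rk X) (rk-mono T⊆X∩T∪A) ⟩
    rk X + rk (X ∩ (T ∪ A))             ∎))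
    where
    open ≤-Reasoning
    X∪A⊆ : X ∪ A ⊆ X ∪ (T ∪ A)
    X∪A⊆ = ∪-mono ⊆-refl (q⊆p∪q T A)
    T⊆X∩T∪A : T ⊆ X ∩ (T ∪ A)
    T⊆X∩T∪A x∈T = x∈p∩q⁺ (T⊆X x∈T , p⊆p∪q A x∈T)

  Spans-∪ : ∀ {T A B} → T Spans A → T Spans B → T Spans (A ∪ B)
  Spans-∪ {T} {A} {B} T⊒A T⊒B = begin
    rk (T ∪ (A ∪ B)) ≡⟨ cong rk (∪-assoc T A B) ⟨
    rk ((T ∪ A) ∪ B) ≤⟨ Spans-⊇ {T} {T ∪ A} (p⊆p∪q A) T⊒B ⟩
    rk (T ∪ A)       ≤⟨ T⊒A ⟩
    rk T             ∎
    where open ≤-Reasoning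

  Spans-⊥ : ∀ {T} → T Spans ⊥
  Spans-⊥ {T} = ≤-reflexive (cong rk (∪-identityʳ T))

  dependent⇒Spans⁅x⁆ : ∀ {T x} → Independent M T → x ∉ T →
    ¬ Independent M (T ∪ ⁅ x ⁆) → T Spans ⁅ x ⁆
  dependent⇒Spans⁅x⁆ {T} {x} indT x∉T depT∪x = ≤-pred
    (subst (rk (T ∪ ⁅ x ⁆) <_) (trans (x∉p⇒∣p∪⁅x⁆∣≡1+∣p∣ x∉T) (cong suc (sym indT)))
           (≤∧≢⇒< (rk-bound _) depT∪x))

  Spans⁅x⁆⇒dependent : ∀ {T x} → Independent M T → x ∉ T →
    T Spans ⁅ x ⁆ → ¬ Independent M (T ∪ ⁅ x ⁆)
  Spans⁅x⁆⇒dependent {T} {x} indT x∉T T⊒x indT∪x = 1+n≰n (begin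
    suc ∣ T ∣        ≡⟨ x∉p⇒∣p∪⁅x⁆∣≡1+∣p∣ x∉T ⟨
    ∣ T ∪ ⁅ x ⁆ ∣    ≡⟨ indT∪x ⟨
    rk (T ∪ ⁅ x ⁆)   ≤⟨ T⊒x ⟩
    rk T             ≡⟨ indT ⟩
    ∣ T ∣            ∎)
    where open ≤-Reasoning

  IsBasisOf : Subset n → Subset n → Set
  IsBasisOf T A = T ⊆ A × Independent M T × T Spans A

  maximal⇒Spans : ∀ {T A} → Independent M T →
    (∀ x → x ∈ A → x ∉ T → ¬ Independent M (T ∪ ⁅ x ⁆)) → T Spans A
  maximal⇒Spans {T} {A} indT maximal with saturate (T Spans_) A extend ⊥ Spans-⊥
    where
    T⊒⁅x⁆ : ∀ x → x ∈ A → T Spans ⁅ x ⁆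
    T⊒⁅x⁆ x x∈A with x ∈? T
    ... | yes x∈T = rk-mono (∪-lub ⊆-refl (x∈p⇒⁅x⁆⊆p x∈T))
    ... | no  x∉T = dependent⇒Spans⁅x⁆ indT x∉T (maximal x x∈A x∉T)
    extend : ∀ S x → T Spans S → x ∈ A → x ∉ S → T Spans (S ∪ ⁅ x ⁆)
    extend S x T⊒S x∈A _ = Spans-∪ T⊒S (T⊒⁅x⁆ x x∈A)
  ... | S′ , ⊥∪A⊆S′ , T⊒S′ = Spans-⊆ (q⊆p∪q ⊥ A) (Spans-⊆ ⊥∪A⊆S′ T⊒S′)

  ∃basis⊇ : ∀ {J A} → J ⊆ A → Independent M J → ∃ λ T → J ⊆ T × IsBasisOf T A
  ∃basis⊇ {J} {A} J⊆A indJ with augment P Maximal step J (J⊆A , indJ)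
    where
    P : Subset n → Set
    P T = T ⊆ A × Independent M T
    Maximal : Subset n → Set
    Maximal T = ∀ x → x ∈ A → x ∉ T → ¬ Independent M (T ∪ ⁅ x ⁆)
    step : ∀ T → P T → Maximal T ⊎ ∃ λ x → x ∉ T × P (T ∪ ⁅ x ⁆)
    step T (T⊆A , _) with any? (λ x → (x ∈? A) ×-dec ¬? (x ∈? T) ×-dec (rk (T ∪ ⁅ x ⁆) ≟ ∣ T ∪ ⁅ x ⁆ ∣))
    ... | yes (x , x∈A , x∉T , indT∪x) = inj₂ (x , x∉T , ∪-lub T⊆A (x∈p⇒⁅x⁆⊆p x∈A) , indT∪x)
    ... | no none = inj₁ λ x x∈A x∉T indT∪x → none (x , x∈A , x∉T , indT∪x)
  ... | T , J⊆T , (T⊆A , indT) , maximal = T , J⊆T , T⊆A , indT , maximal⇒Spans indT maximal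

  module _ {I : Subset n → Set} (ideal : IsOrderIdeal M I) where

    modularIdeal⇒independent : IsModularIdeal M I → ∀ X → Independent M X → I X
    modularIdeal⇒independent ((Z , Z∈I) , _ , singletons , unions) X indX
      with saturate (λ S → I S × S ⊆ X) X extend ⊥ (ideal ⊥ Z (⊆-min Z) Z∈I , ⊆-min X)
      where
      extend : ∀ S x → I S × S ⊆ X → x ∈ X → x ∉ S → I (S ∪ ⁅ x ⁆) × S ∪ ⁅ x ⁆ ⊆ X
      extend S x (S∈I , S⊆X) x∈X x∉S = unions S ⁅ x ⁆ S∈I x∈I (S≢⁅x⁆ , modular) , S∪x⊆X
        where
        S∪x⊆X : S ∪ ⁅ x ⁆ ⊆ X
        S∪x⊆X = ∪-lub S⊆X (x∈p⇒⁅x⁆⊆p x∈X)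
        x∈I : I ⁅ x ⁆
        x∈I = singletons x (λ circuit → proj₁ circuit (independent-⊆ (x∈p⇒⁅x⁆⊆p x∈X) indX))
        S≢⁅x⁆ : S ≢ ⁅ x ⁆
        S≢⁅x⁆ S≡⁅x⁆ = x∉S (subst (x ∈_) (sym S≡⁅x⁆) (x∈⁅x⁆ x))
        modular : rk (S ∩ ⁅ x ⁆) + rk (S ∪ ⁅ x ⁆) ≡ rk S + rk ⁅ x ⁆
        modular = independent⇒modular S ⁅ x ⁆ (independent-⊆ S∪x⊆X indX)
    ... | S′ , ⊥∪X⊆S′ , S′∈I , _ = ideal X S′ (⊥∪X⊆S′ ∘ q⊆p∪q ⊥ X) S′∈I

    modularIdeal⇒extension : IsModularIdeal M I → ModularExtensionByCircuits M I
    modularIdeal⇒extension (_ , _ , _ , unions) X S x X∈I circuitX S∈I x∈X X⊆S∪x with x ∈? S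
    ... | yes x∈S = ideal (S ∪ ⁅ x ⁆) S (∪-lub ⊆-refl (x∈p⇒⁅x⁆⊆p x∈S)) S∈I
    ... | no  x∉S = ideal (S ∪ ⁅ x ⁆) (S ∪ X) (∪-mono ⊆-refl (x∈p⇒⁅x⁆⊆p x∈X))
                      (unions S X S∈I X∈I (S≢X , modular))
      where
      S≢X : S ≢ X
      S≢X S≡X = x∉S (subst (x ∈_) (sym S≡X) x∈X)
      modular : rk (S ∩ X) + rk (S ∪ X) ≡ rk S + rk X
      modular = rk≤rk∩⇒modular S X (circuit-rk≤rk∩ circuitX x∈X X⊆S∪x x∉S)

    modularIdeal⇒conditions : IsModularIdeal M I →
      IsLinearClass M (IdealCircuits M I) × (∀ X → Independent M X → I X)
      × ModularExtensionByCircuits M I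
    modularIdeal⇒conditions modularIdeal@(_ , _ , _ , unions) =
      (linear , modularIdeal⇒independent modularIdeal , modularIdeal⇒extension modularIdeal)
      where
      linear : IsLinearClass M (IdealCircuits M I)
      linear = (λ _ → proj₂)
             , λ X Y (X∈I , _) (Y∈I , _) modular C circuitC C⊆X∪Y →
                 ideal C (X ∪ Y) C⊆X∪Y (unions X Y X∈I Y∈I modular) , circuitC

    module _ (independent∈I : ∀ X → Independent M X → I X)
             (extension : ModularExtensionByCircuits M I) where

      extendByBasis : ∀ {T A S} → I A → IsBasisOf T A → I S → T ⊆ S → I (S ∪ A)
      extendByBasis {T} {A} {S} A∈I (T⊆A , indT , T⊒A) S∈I T⊆S
        with saturate (λ S → I S × T ⊆ S) A extend S (S∈I , T⊆S)
        where
        extend : ∀ S x → I S × T ⊆ S → x ∈ A → x ∉ S → I (S ∪ ⁅ x ⁆) × T ⊆ S ∪ ⁅ x ⁆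
        extend S x (S∈I , T⊆S) x∈A x∉S with fundamentalCircuit indT depT∪x
          where
          depT∪x : ¬ Independent M (T ∪ ⁅ x ⁆)
          depT∪x = Spans⁅x⁆⇒dependent indT (λ x∈T → x∉S (T⊆S x∈T))
                                       (Spans-⊆ (x∈p⇒⁅x⁆⊆p x∈A) T⊒A)
        ... | C , circuitC , x∈C , C⊆T∪x =
          extension C S x C∈I circuitC S∈I x∈C (⊆-trans C⊆T∪x (∪-mono T⊆S ⊆-refl))
          , ⊆-trans T⊆S (p⊆p∪q ⁅ x ⁆)
          where
          C∈I : I C
          C∈I = ideal C A (⊆-trans C⊆T∪x (∪-lub T⊆A (x∈p⇒⁅x⁆⊆p x∈A))) A∈I
      ... | S′ , S∪A⊆S′ , S′∈I , _ = ideal (S ∪ A) S′ S∪A⊆S′ S′∈I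

      unionOfModularPair∈I : ∀ A B → I A → I B → ModularPair M A B → I (A ∪ B)
      unionOfModularPair∈I A B A∈I B∈I (_ , modular)
        with ∃basis⊇ (⊆-min (A ∩ B)) independent-⊥
      ... | J , _ , J⊆A∩B , indJ , J⊒A∩B
        with ∃basis⊇ (⊆-trans J⊆A∩B (p∩q⊆p A B)) indJ
           | ∃basis⊇ (⊆-trans J⊆A∩B (p∩q⊆q A B)) indJ
      ... | TA , J⊆TA , basisA@(TA⊆A , indTA , TA⊒A)
          | TB , J⊆TB , basisB@(TB⊆B , indTB , TB⊒B) =
        ideal (A ∪ B) ((U ∪ A) ∪ B) (∪-mono (q⊆p∪q U A) ⊆-refl)
          (extendByBasis B∈I basisB
            (extendByBasis A∈I basisA (independent∈I U indU) (p⊆p∪q TB))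
            (⊆-trans (q⊆p∪q TA TB) (p⊆p∪q A)))
        where
        U : Subset n
        U = TA ∪ TB
        U⊒A∪B : U Spans (A ∪ B)
        U⊒A∪B = Spans-∪ (Spans-⊇ (p⊆p∪q TB) TA⊒A) (Spans-⊇ (q⊆p∪q TA TB) TB⊒B)
        open ≤-Reasoning
        counting : ∣ U ∣ + rk J ≤ rk U + rk J
        counting = begin
          ∣ U ∣ + rk J              ≡⟨ cong (∣ U ∣ +_) indJ ⟩
          ∣ U ∣ + ∣ J ∣             ≤⟨ +-monoʳ-≤ ∣ U ∣ (p⊆q⇒∣p∣≤∣q∣ (λ x∈J → x∈p∩q⁺ (J⊆TA x∈J , J⊆TB x∈J))) ⟩
          ∣ U ∣ + ∣ TA ∩ TB ∣       ≡⟨ ∣p∪q∣+∣p∩q∣≡∣p∣+∣q∣ TA TB ⟩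
          ∣ TA ∣ + ∣ TB ∣           ≡⟨ cong₂ _+_ indTA indTB ⟨
          rk TA + rk TB             ≤⟨ +-mono-≤ (rk-mono TA⊆A) (rk-mono TB⊆B) ⟩
          rk A + rk B               ≡⟨ modular ⟨
          rk (A ∩ B) + rk (A ∪ B)   ≤⟨ +-mono-≤ (Spans⇒rk≤ J⊒A∩B) (Spans⇒rk≤ U⊒A∪B) ⟩
          rk J + rk U               ≡⟨ +-comm (rk J) (rk U) ⟩
          rk U + rk J               ∎
        indU : Independent M U
        indU = ≤-antisym (rk-bound U) (+-cancelʳ-≤ (rk J) ∣ U ∣ (rk U) counting)

      conditions⇒modularIdeal : IsModularIdeal M I
      conditions⇒modularIdeal =
        (⊥ , independent∈I ⊥ independent-⊥) , ideal
        , (λ x nonLoop → independent∈I ⁅ x ⁆ (nonLoop⇒independent nonLoop))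
        , unionOfModularPair∈I

mainTheorem4 : ∀ {n : ℕ} (M : Matroid n) (I : Subset n → Set) →
    IsOrderIdeal M I →
    IsModularIdeal M I ⇔
      (IsLinearClass M (IdealCircuits M I)
       × (∀ X → Independent M X → I X)
       × ModularExtensionByCircuits M I)
mainTheorem4 M I ideal = mk⇔
  (modularIdeal⇒conditions M ideal)
  (λ (_ , independent∈I , extension) → conditions⇒modularIdeal M ideal independent∈I extension)
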